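{- Let $\mathbf L=(L,\lor,\land,*,1)$ be a lattice skew Hilbert algebra, $\Theta$ a congruence of $\mathbf L$, $F$ a filter of $\mathbf L$, and $a\in L$. Then: (i) every class of $\Theta$ is a convex subset of $(L,\leq)$; (ii) $F$ is a deductive system of $\mathbf L$; (iii) $F$ is a lattice filter of $(L,\lor,\land)$ (i.e. $x\in F$ implies $x\lor y\in F$ for all $y\in L$, and $x,y\in F$ implies $x\land y\in F$); (iv) $a*(x\land a)\in F$ for all $x\in F$, and $(x*(y*a))*a\in F$ for all $x,y\in F$.
   Context: A lattice skew Hilbert algebra is an algebra $(L,\lor,\land,*,1)$ where $(L,\lor,\land)$ is a lattice (with order $\leq$) and the identities $x*(x\lor y)\approx1$, $x*((x*y)*y)\approx1$, $((x\lor y)*z)*(x*z)\approx1$, $(x\lor y)\land(x*y)\approx y$ hold. A filter of $\mathbf L$ is a subset $F\subseteq L$ containing $1$ such that for all $x,y,z,v\in L$, if $x*y,y*x,z*v,v*z\in F$ then $(x\lor z)*(y\lor v)$, $(x\land z)*(y\land v)$, $(x*z)*(y*v)\in F$. A deductive system is a subset $D$ containing $1$ such that $a\in D$, $b\in L$ and $a*b\in D$ imply $b\in D$. -}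

module Defs where

open import Level using (Level; suc; _⊔_)
open import Relation.Binary.PropositionalEquality using (_≡_)
open import Relation.Binary.Structures using (IsEquivalence)
open import Data.Product using (_×_)

record LatticeSkewHilbertAlgebra (c : Level) : Set (suc c) where
  infixr 6 _∨_
  infixr 7 _∧_
  infixr 5 _*_
  field
    Carrier : Set c
    _∨_ _∧_ _*_ : Carrier → Carrier → Carrier
    𝟏 : Carrier
    ∨-comm  : ∀ x y → x ∨ y ≡ y ∨ x
    ∧-comm  : ∀ x y → x ∧ y ≡ y ∧ x
    ∨-assoc : ∀ x y z → (x ∨ y) ∨ z ≡ x ∨ (y ∨ z)
    ∧-assoc : ∀ x y z → (x ∧ y) ∧ z ≡ x ∧ (y ∧ z)
    ∨-absorbs-∧ : ∀ x y → x ∨ (x ∧ y) ≡ x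
    ∧-absorbs-∨ : ∀ x y → x ∧ (x ∨ y) ≡ x
    ax1 : ∀ x y → x * (x ∨ y) ≡ 𝟏
    ax2 : ∀ x y → x * ((x * y) * y) ≡ 𝟏
    ax3 : ∀ x y z → ((x ∨ y) * z) * (x * z) ≡ 𝟏
    ax4 : ∀ x y → (x ∨ y) ∧ (x * y) ≡ y

  _≤_ : Carrier → Carrier → Set c
  x ≤ y = x ∨ y ≡ y

module _ {c : Level} (𝐋 : LatticeSkewHilbertAlgebra c) where
  open LatticeSkewHilbertAlgebra 𝐋

  record IsCongruence {ℓ : Level} (Θ : Carrier → Carrier → Set ℓ) : Set (c ⊔ ℓ) where
    field
      isEquivalence : IsEquivalence Θ
      ∨-cong : ∀ {x y z v} → Θ x y → Θ z v → Θ (x ∨ z) (y ∨ v)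
      ∧-cong : ∀ {x y z v} → Θ x y → Θ z v → Θ (x ∧ z) (y ∧ v)
      *-cong : ∀ {x y z v} → Θ x y → Θ z v → Θ (x * z) (y * v)

  Convex : {ℓ : Level} → (Carrier → Set ℓ) → Set (c ⊔ ℓ)
  Convex S = ∀ {x y z} → S x → S z → x ≤ y → y ≤ z → S y

  record IsFilter {ℓ : Level} (F : Carrier → Set ℓ) : Set (c ⊔ ℓ) where
    field
      one∈ : F 𝟏
      closed : ∀ {x y z v} → F (x * y) → F (y * x) → F (z * v) → F (v * z) →
               F ((x ∨ z) * (y ∨ v)) × F ((x ∧ z) * (y ∧ v)) × F ((x * z) * (y * v))

  IsDeductiveSystem : {ℓ : Level} → (Carrier → Set ℓ) → Set (c ⊔ ℓ)
  IsDeductiveSystem D = D 𝟏 × (∀ {a b} → D a → D (a * b) → D b)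

  IsLatticeFilter : {ℓ : Level} → (Carrier → Set ℓ) → Set (c ⊔ ℓ)
  IsLatticeFilter F = (∀ {x} y → F x → F (x ∨ y)) × (∀ {x y} → F x → F y → F (x ∧ y))

-- A filter F induces the relation x ≈ y :⇔ x * y ∈ F and y * x ∈ F, which by the
-- filter axiom is compatible with ∨, ∧ and *.  Since 𝟏 * x = x and x * 𝟏 = 𝟏, F is
-- exactly the ≈-class of 𝟏, so each closure property of F is obtained by replacing
-- members of F by 𝟏 inside a term and simplifying.
module Submission where

open import Defs
open import Level using (Level)
open import Data.Product using (_×_; _,_; proj₁; proj₂; swap)
open import Relation.Binary.PropositionalEquality using (_≡_; sym; trans; cong; cong₂; subst; subst₂)
open import Relation.Binary.Structures using (IsEquivalence)

module _ {c : Level} (𝐋 : LatticeSkewHilbertAlgebra c) where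
  open LatticeSkewHilbertAlgebra 𝐋

  ∨-idem : ∀ x → x ∨ x ≡ x
  ∨-idem x = trans (cong (x ∨_) (sym (∧-absorbs-∨ x x))) (∨-absorbs-∧ x (x ∨ x))

  x*x≡𝟏 : ∀ x → x * x ≡ 𝟏
  x*x≡𝟏 x = trans (cong (x *_) (sym (∨-idem x))) (ax1 x x)

  ∧-identityʳ : ∀ x → x ∧ 𝟏 ≡ x
  ∧-identityʳ x = trans (cong₂ _∧_ (sym (∨-idem x)) (sym (x*x≡𝟏 x))) (ax4 x x)

  ∧-identityˡ : ∀ x → 𝟏 ∧ x ≡ x
  ∧-identityˡ x = trans (∧-comm 𝟏 x) (∧-identityʳ x)

  ∨-zeroˡ : ∀ x → 𝟏 ∨ x ≡ 𝟏
  ∨-zeroˡ x = trans (cong (𝟏 ∨_) (trans (sym (∧-identityʳ x)) (∧-comm x 𝟏))) (∨-absorbs-∧ 𝟏 x)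

  *-zeroʳ : ∀ x → x * 𝟏 ≡ 𝟏
  *-zeroʳ x = trans (cong (x *_) (sym (trans (∨-comm x 𝟏) (∨-zeroˡ x)))) (ax1 x 𝟏)

  *-identityˡ : ∀ x → 𝟏 * x ≡ x
  *-identityˡ x =
    trans (sym (∧-identityˡ (𝟏 * x)))
          (trans (cong (_∧ (𝟏 * x)) (sym (∨-zeroˡ x))) (ax4 𝟏 x))

  ∨-compatible-classes-convex : {ℓ : Level} {Θ : Carrier → Carrier → Set ℓ} →
    IsEquivalence Θ → (∀ {x y z v} → Θ x y → Θ z v → Θ (x ∨ z) (y ∨ v)) →
    ∀ b → Convex 𝐋 (Θ b)
  ∨-compatible-classes-convex {Θ = Θ} isEq ∨-cong b {x} {y} {z} bx bz x≤y y≤z =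
    Θ.trans bz (Θ.sym y~z)
    where
      module Θ = IsEquivalence isEq
      y~z : Θ y z
      y~z = subst₂ Θ (trans (∨-comm y x) x≤y) y≤z (∨-cong Θ.refl (Θ.trans (Θ.sym bx) bz))

  module FilterProperties {ℓ : Level} {F : Carrier → Set ℓ} (isFilter : IsFilter 𝐋 F) where
    open IsFilter isFilter

    infix 4 _≈_
    _≈_ : Carrier → Carrier → Set ℓ
    x ≈ y = F (x * y) × F (y * x)

    ≈-refl : ∀ {x} → x ≈ x
    ≈-refl {x} = F𝟏 , F𝟏
      where F𝟏 = subst F (sym (x*x≡𝟏 x)) one∈

    ≈-sym : ∀ {x y} → x ≈ y → y ≈ x
    ≈-sym = swap

    ≈-respʳ : ∀ {x y y′} → y ≡ y′ → x ≈ y → x ≈ y′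
    ≈-respʳ {x} = subst (x ≈_)

    ∈⇒≈𝟏 : ∀ {x} → F x → x ≈ 𝟏
    ∈⇒≈𝟏 {x} x∈F = subst F (sym (*-zeroʳ x)) one∈ , subst F (sym (*-identityˡ x)) x∈F

    ≈𝟏⇒∈ : ∀ {x} → x ≈ 𝟏 → F x
    ≈𝟏⇒∈ {x} (_ , 𝟏*x∈F) = subst F (*-identityˡ x) 𝟏*x∈F

    ∨-resp-≈ : ∀ {x y z v} → x ≈ y → z ≈ v → x ∨ z ≈ y ∨ v
    ∨-resp-≈ (xy , yx) (zv , vz) = proj₁ (closed xy yx zv vz) , proj₁ (closed yx xy vz zv)

    ∧-resp-≈ : ∀ {x y z v} → x ≈ y → z ≈ v → x ∧ z ≈ y ∧ v
    ∧-resp-≈ (xy , yx) (zv , vz) =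
      proj₁ (proj₂ (closed xy yx zv vz)) , proj₁ (proj₂ (closed yx xy vz zv))

    *-resp-≈ : ∀ {x y z v} → x ≈ y → z ≈ v → x * z ≈ y * v
    *-resp-≈ (xy , yx) (zv , vz) =
      proj₂ (proj₂ (closed xy yx zv vz)) , proj₂ (proj₂ (closed yx xy vz zv))

    ∈⇒*-≈ : ∀ {x} y → F x → x * y ≈ y
    ∈⇒*-≈ y x∈F = ≈-respʳ (*-identityˡ y) (*-resp-≈ (∈⇒≈𝟏 x∈F) ≈-refl)

    isDeductiveSystem : IsDeductiveSystem 𝐋 F
    isDeductiveSystem = one∈ , modusPonens
      where
        -- 𝟏 = (a * b) * (a * b) ≈ 𝟏 * b = b, replacing the first a * b by 𝟏 and the second by b.
        modusPonens : ∀ {a b} → F a → F (a * b) → F b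
        modusPonens {a} {b} a∈F a*b∈F =
          ≈𝟏⇒∈ (≈-sym (subst₂ _≈_ (x*x≡𝟏 (a * b)) (*-identityˡ b)
                        (*-resp-≈ (∈⇒≈𝟏 a*b∈F) (∈⇒*-≈ b a∈F))))

    isLatticeFilter : IsLatticeFilter 𝐋 F
    isLatticeFilter = ∨-closed , ∧-closed
      where
        ∨-closed : ∀ {x} y → F x → F (x ∨ y)
        ∨-closed y x∈F = ≈𝟏⇒∈ (≈-respʳ (∨-zeroˡ y) (∨-resp-≈ (∈⇒≈𝟏 x∈F) ≈-refl))

        ∧-closed : ∀ {x y} → F x → F y → F (x ∧ y)
        ∧-closed x∈F y∈F = ≈𝟏⇒∈ (≈-respʳ (∧-identityʳ 𝟏) (∧-resp-≈ (∈⇒≈𝟏 x∈F) (∈⇒≈𝟏 y∈F)))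

    *-∧-closed : ∀ a {x} → F x → F (a * (x ∧ a))
    *-∧-closed a x∈F = proj₂ (≈-respʳ (∧-identityˡ a) (∧-resp-≈ (∈⇒≈𝟏 x∈F) ≈-refl))

    *-*-closed : ∀ a {x y} → F x → F y → F ((x * (y * a)) * a)
    *-*-closed a x∈F y∈F =
      proj₁ (≈-respʳ (*-identityˡ a) (*-resp-≈ (∈⇒≈𝟏 x∈F) (∈⇒*-≈ a y∈F)))

mainTheorem10 : {c ℓ₁ ℓ₂ : Level} (𝐋 : LatticeSkewHilbertAlgebra c)
    (Θ : LatticeSkewHilbertAlgebra.Carrier 𝐋 → LatticeSkewHilbertAlgebra.Carrier 𝐋 → Set ℓ₁)
    (F : LatticeSkewHilbertAlgebra.Carrier 𝐋 → Set ℓ₂)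
    (a : LatticeSkewHilbertAlgebra.Carrier 𝐋) →
    IsCongruence 𝐋 Θ → IsFilter 𝐋 F →
    (∀ b → Convex 𝐋 (Θ b))
    × IsDeductiveSystem 𝐋 F
    × IsLatticeFilter 𝐋 F
    × (∀ x → F x → F (LatticeSkewHilbertAlgebra._*_ 𝐋 a (LatticeSkewHilbertAlgebra._∧_ 𝐋 x a)))
    × (∀ x y → F x → F y →
         F (LatticeSkewHilbertAlgebra._*_ 𝐋
              (LatticeSkewHilbertAlgebra._*_ 𝐋 x (LatticeSkewHilbertAlgebra._*_ 𝐋 y a)) a))
mainTheorem10 𝐋 Θ F a isCongruence isFilter =
  ∨-compatible-classes-convex 𝐋 isEquivalence ∨-cong ,
  isDeductiveSystem ,
  isLatticeFilter ,
  (λ x → *-∧-closed a) ,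
  (λ x y → *-*-closed a)
  where
    open IsCongruence isCongruence
    open FilterProperties 𝐋 isFilter
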